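{- For $s\ge 2$, let $G=sK_3\vee K_1$ (the join of $s$ disjoint triangles with a single vertex) and let $n=3s+1$. Then $\operatorname{ft}(G)=\frac{n-1}{3}+1$, $\operatorname{Z}^*(G)=\frac{n-1}{2}$, and $\operatorname{Z}(G)=\frac{2(n-1)}{3}+1$.
   Context: Zero forcing: given $B\subseteq V(G)$ initially filled, a filled vertex $u$ may force an unfilled vertex $w$ if $w$ is the only unfilled neighbor of $u$; $B$ is a zero forcing set if repeated forcing fills all vertices; $\operatorname{Z}(G)$ is the minimum size of a zero forcing set. A fort of $G$ is a nonempty $F\subseteq V(G)$ such that every $v\in V(G)\setminus F$ has $|N_G(v)\cap F|\neq 1$; a minimal fort is one not properly containing another fort. $\operatorname{ft}(G)$ is the maximum number of pairwise disjoint forts of $G$. $\operatorname{Z}^*(G)=\min\{\sum_{v}x_v : \sum_{v\in F}x_v\ge 1 \text{ for every minimal fort } F,\ x_v\ge 0\}$. -}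

module Defs where

open import Data.Bool using (Bool; true; false; not; _∧_; if_then_else_)
open import Data.Nat using (ℕ; zero; suc; _+_; _*_; _∸_; _≤_; _≡ᵇ_)
open import Data.Nat.DivMod using (_/_)
open import Data.Fin using (Fin; zero; suc; toℕ)
open import Data.Fin.Subset using (Subset; _∈_; _∉_; _⊆_; _∩_; ∣_∣; Nonempty; Empty)
open import Data.Vec using (tabulate)
open import Data.Vec.Functional using (foldr)
open import Data.Product using (Σ; ∃; _×_)
open import Data.Integer using (+_)
open import Data.Rational using (ℚ; 0ℚ; 1ℚ) renaming (_+_ to _+ℚ_; _≤_ to _≤ℚ_)
open import Relation.Binary.PropositionalEquality using (_≡_; _≢_)

record Graph (n : ℕ) : Set where
  field
    adj   : Fin n → Fin n → Bool
    sym   : ∀ u v → adj u v ≡ adj v u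
    irrefl : ∀ v → adj v v ≡ false
open Graph public

Adj : ∀ {n} → Graph n → Fin n → Fin n → Set
Adj G u v = adj G u v ≡ true

N : ∀ {n} → Graph n → Fin n → Subset n
N G v = tabulate (adj G v)

data Filled {n} (G : Graph n) (B : Subset n) : Fin n → Set where
  initial : ∀ {v} → v ∈ B → Filled G B v
  force   : ∀ {u w} → Adj G u w → Filled G B u →
            (∀ x → Adj G u x → x ≢ w → Filled G B x) → Filled G B w

IsZeroForcingSet : ∀ {n} → Graph n → Subset n → Set
IsZeroForcingSet G B = ∀ v → Filled G B v

ZeroForcingNumberIs : ∀ {n} → Graph n → ℕ → Set
ZeroForcingNumberIs {n} G k =
  (Σ (Subset n) λ B → IsZeroForcingSet G B × ∣ B ∣ ≡ k) ×
  (∀ (B : Subset n) → IsZeroForcingSet G B → k ≤ ∣ B ∣)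

IsFort : ∀ {n} → Graph n → Subset n → Set
IsFort G F = Nonempty F × (∀ v → v ∉ F → ∣ N G v ∩ F ∣ ≢ 1)

IsMinimalFort : ∀ {n} → Graph n → Subset n → Set
IsMinimalFort {n} G F = IsFort G F × (∀ (F' : Subset n) → IsFort G F' → F' ⊆ F → F ⊆ F')

DisjointForts : ∀ {n} → Graph n → (k : ℕ) → (Fin k → Subset n) → Set
DisjointForts G k Fs = (∀ i → IsFort G (Fs i)) × (∀ i j → i ≢ j → Empty (Fs i ∩ Fs j))

FortNumberIs : ∀ {n} → Graph n → ℕ → Set
FortNumberIs {n} G k =
  (Σ (Fin k → Subset n) λ Fs → DisjointForts G k Fs) ×
  (∀ (m : ℕ) (Fs : Fin m → Subset n) → DisjointForts G m Fs → m ≤ k)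

sumℚ : ∀ {n} → (Fin n → ℚ) → ℚ
sumℚ x = foldr _+ℚ_ 0ℚ x

sumOver : ∀ {n} → Subset n → (Fin n → ℚ) → ℚ
sumOver F x = sumℚ (λ v → if Data.Vec.lookup F v then x v else 0ℚ)
  where import Data.Vec

FeasibleZStar : ∀ {n} → Graph n → (Fin n → ℚ) → Set
FeasibleZStar {n} G x =
  (∀ v → 0ℚ ≤ℚ x v) × (∀ (F : Subset n) → IsMinimalFort G F → 1ℚ ≤ℚ sumOver F x)

ZStarIs : ∀ {n} → Graph n → ℚ → Set
ZStarIs {n} G q =
  (Σ (Fin n → ℚ) λ x → FeasibleZStar G x × sumℚ x ≡ q) ×
  (∀ (x : Fin n → ℚ) → FeasibleZStar G x → q ≤ℚ sumℚ x)

-- G = s K_3 ∨ K_1 on Fin (3s+1): vertex 0 is the apex (K_1);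
-- vertex (suc i), i : Fin (3s), lies in triangle number ⌊i/3⌋.
sK3∨K1-adj : (s : ℕ) → Fin (suc (3 * s)) → Fin (suc (3 * s)) → Bool
sK3∨K1-adj s zero    zero    = false
sK3∨K1-adj s zero    (suc _) = true
sK3∨K1-adj s (suc _) zero    = true
sK3∨K1-adj s (suc i) (suc j) = not (toℕ i ≡ᵇ toℕ j) ∧ (toℕ i / 3 ≡ᵇ toℕ j / 3)

private
  open import Relation.Binary.PropositionalEquality using (refl; cong₂)

  ≡ᵇ-sym : ∀ a b → (a ≡ᵇ b) ≡ (b ≡ᵇ a)
  ≡ᵇ-sym zero zero = refl
  ≡ᵇ-sym zero (suc b) = refl
  ≡ᵇ-sym (suc a) zero = refl
  ≡ᵇ-sym (suc a) (suc b) = ≡ᵇ-sym a b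

  ≡ᵇ-refl : ∀ a → (a ≡ᵇ a) ≡ true
  ≡ᵇ-refl zero = refl
  ≡ᵇ-refl (suc a) = ≡ᵇ-refl a

  sK3∨K1-sym : ∀ s u v → sK3∨K1-adj s u v ≡ sK3∨K1-adj s v u
  sK3∨K1-sym s zero zero = refl
  sK3∨K1-sym s zero (suc _) = refl
  sK3∨K1-sym s (suc _) zero = refl
  sK3∨K1-sym s (suc i) (suc j) =
    cong₂ (λ a b → not a ∧ b) (≡ᵇ-sym (toℕ i) (toℕ j)) (≡ᵇ-sym (toℕ i / 3) (toℕ j / 3))

  sK3∨K1-irrefl : ∀ s v → sK3∨K1-adj s v v ≡ false
  sK3∨K1-irrefl s zero = refl
  sK3∨K1-irrefl s (suc i) rewrite ≡ᵇ-refl (toℕ i) = refl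

sK3∨K1 : (s : ℕ) → Graph (suc (3 * s))
sK3∨K1 s = record { adj = sK3∨K1-adj s ; sym = sK3∨K1-sym s ; irrefl = sK3∨K1-irrefl s }

{-# OPTIONS --safe #-}

-- Number the corners of triangle t by r ∈ {0, 1, 2}. Any two corners of one triangle form a
-- minimal fort, and so does any set containing the apex and a corner of every triangle.
--
-- ft: the pairs {1, 2} of the triangles, together with the apex and all corners 0, are s + 1
-- disjoint forts. Conversely a fort without the apex misses at most one corner of any triangle it
-- meets, so two disjoint forts cannot both avoid the apex and meet the same triangle; labelling a
-- fort by the apex or by a triangle it meets is therefore injective on disjoint families.
--
-- Z*: the pair forts force weight at least 3/2 on every triangle, and weight ½ on each corner
-- covers every fort, because (using s ≥ 2) every fort contains two corners.
--
-- Z: a zero forcing set meets every pair fort, so it contains two corners of each triangle. If it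
-- avoids the apex and contains exactly two corners of each triangle, its complement is a fort that
-- it does not meet, which is impossible; so it has at least 2s + 1 vertices. The apex with the
-- corners 0 and 1 of every triangle attains this, corner 2 being forced by corner 0.

module Submission where

open import Defs hiding (sym)
open import Data.Nat using (ℕ; suc; _+_; _*_; _∸_; _≤_)
open import Data.Nat.DivMod using (_/_)
open import Data.Integer using (+_)
open import Data.Rational using (ℚ) renaming (_/_ to _/ℚ_)
open import Data.Product using (_×_)

open import Algebra.Bundles using (Monoid; CommutativeMonoid)
import Algebra.Properties.Monoid.Sum as MonoidSum
import Algebra.Properties.CommutativeMonoid.Sum as CommutativeMonoidSum
open import Data.Bool using (Bool; true; false; T; not; _∧_; _∨_; if_then_else_)
open import Data.Bool.Properties using (T-≡; T-∨)
open import Data.Empty using (⊥; ⊥-elim)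
open import Data.Fin
  using (Fin; zero; suc; toℕ; inject≤; cast; combine; remQuot; punchIn; punchOut; _↑ˡ_; _↑ʳ_)
import Data.Fin as Fin
open import Data.Fin.Patterns using (0F; 1F; 2F)
open import Data.Fin.Properties
  using (all?; any?; ¬∀⟶∃¬; injective⇒≤; inject≤-injective; toℕ<n; toℕ-injective; suc-injective;
         cast-is-id; cast-involutive; toℕ-cast; toℕ-combine; remQuot-combine; combine-remQuot;
         punchInᵢ≢i; punchIn-injective; punchIn-punchOut)
open import Data.Fin.Subset
  using (Subset; ∁; _∈_; _∉_; _⊆_; _∩_; _∪_; _-_; ⁅_⁆; ∣_∣; Nonempty; Empty)
open import Data.Fin.Subset.Properties
  using (_∈?_; x∉p⇒x∈∁p; x∈∁p⇒x∉p; Empty-unique; ∣⊥∣≡0; ∣⁅x⁆∣≡1; x∈⁅x⁆; x∈⁅y⁆⇒x≡y; ⊆-antisym;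
         p⊆q⇒∣p∣≤∣q∣; x∈p∧x≢y⇒x∈p-y; x∈p⇒∣p-x∣<∣p∣; x∈p∩q⁺; x∈p∩q⁻; x∈p∪q⁺; x∈p∪q⁻)
import Data.Integer.Solver
open import Data.Nat using (zero)
import Data.Nat as ℕ
open import Data.Nat.DivMod using (+-distrib-/-∣ˡ; m*n/n≡m; m<n⇒m/n≡0)
open import Data.Nat.Divisibility using (m∣m*n)
import Data.Nat.Properties as ℕ
open import Data.Product using (∃; ∃₂; _,_; proj₁; proj₂; uncurry)
open import Data.Product.Properties using (×-≡,≡←≡)
open import Data.Rational using (0ℚ; 1ℚ; ½)
import Data.Rational as ℚ
import Data.Rational.Properties as ℚ
import Data.Rational.Solver
open import Data.Rational.Unnormalised using (mkℚᵘ; *≡*)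
import Data.Rational.Unnormalised as ℚᵘ
import Data.Rational.Unnormalised.Properties as ℚᵘ
open import Data.Sum using (_⊎_; inj₁; inj₂)
import Data.Sum as Sum
open import Data.Vec using (_∷_; []; lookup; tabulate; here)
open import Data.Vec.Properties using (lookup∘tabulate; []=⇒lookup; lookup⇒[]=)
open import Data.Vec.Functional using (Vector; removeAt)
open import Data.Vec.Functional.Relation.Binary.Pointwise.Properties using (foldr-cong)
open import Function using (_∘_; id; Equivalence)
open import Relation.Binary.PropositionalEquality
  using (_≡_; _≢_; refl; sym; trans; cong; cong₂; subst; module ≡-Reasoning)
open import Relation.Nullary using (¬_; yes; no; does; contradiction)
open import Relation.Nullary.Decidable using (from-yes; ¬?; _→-dec_; dec-true)

module _ {c ℓ} (M : Monoid c ℓ) where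
  open Monoid M
    using (Carrier; _≈_; _∙_; ε; ∙-congˡ; identityˡ; assoc)
    renaming (refl to ≈-refl; sym to ≈-sym; trans to ≈-trans)
  open MonoidSum M using (sum; sum-syntax; sum-cong-≗)

  sum-splitAt : ∀ m {n} (f : Vector Carrier (m ℕ.+ n)) →
                sum f ≈ sum (f ∘ (_↑ˡ n)) ∙ sum (f ∘ (m ↑ʳ_))
  sum-splitAt zero    f = ≈-sym (identityˡ _)
  sum-splitAt (suc m) f = ≈-trans (∙-congˡ (sum-splitAt m (f ∘ suc))) (≈-sym (assoc _ _ _))

  sum-combine : ∀ m {n} (f : Vector Carrier (m ℕ.* n)) →
                sum f ≈ ∑[ i < m ] ∑[ j < n ] f (combine i j)
  sum-combine zero    f = ≈-refl
  sum-combine (suc m) {n} f = ≈-trans (sum-splitAt n f) (∙-congˡ (sum-combine m (f ∘ (n ↑ʳ_))))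

  sum-cast : ∀ {m n} (eq : m ≡ n) (f : Vector Carrier n) → sum (f ∘ cast eq) ≡ sum f
  sum-cast refl f = sum-cong-≗ (cong f ∘ cast-is-id refl)

module _ {c ℓ} (M : CommutativeMonoid c ℓ) where
  open CommutativeMonoid M
    using (Carrier; _≈_; _∙_; ε; ∙-cong; ∙-congˡ; identityʳ; setoid)
    renaming (reflexive to ≈-reflexive; trans to ≈-trans)
  open CommutativeMonoidSum M using (sum; sum-remove; sum-cong-≋; sum-replicate-zero)
  open import Relation.Binary.Reasoning.Setoid setoid

  sum-pair : ∀ {n} {f : Vector Carrier n} {p q} → p ≢ q →
             (∀ v → v ≢ p → v ≢ q → f v ≈ ε) → sum f ≈ f p ∙ f q
  sum-pair {suc zero}    {p = zero} {zero} p≢q _ = contradiction refl p≢q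
  sum-pair {suc (suc n)} {f} {p} {q} p≢q vanish = begin
    sum f                              ≈⟨ sum-remove f ⟩
    f p ∙ sum g                        ≈⟨ ∙-congˡ (sum-remove g) ⟩
    f p ∙ (g q′ ∙ sum (removeAt g q′)) ≈⟨ ∙-congˡ (∙-cong (≈-reflexive (cong f (punchIn-punchOut p≢q))) rest≈ε) ⟩
    f p ∙ (f q ∙ ε)                    ≈⟨ ∙-congˡ (identityʳ (f q)) ⟩
    f p ∙ f q                          ∎
    where
      g : Vector Carrier (suc n)
      g = removeAt f p
      q′ : Fin (suc n)
      q′ = punchOut p≢q
      rest≈ε : sum (removeAt g q′) ≈ ε
      rest≈ε = ≈-trans (sum-cong-≋ {y = λ _ → ε} λ v → vanish _ (punchInᵢ≢i p _) λ e →
                 punchInᵢ≢i q′ v (punchIn-injective p _ _ (trans e (sym (punchIn-punchOut p≢q)))))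
                     (sum-replicate-zero n)

module ℕΣ = CommutativeMonoidSum ℕ.+-0-commutativeMonoid
open ℕΣ using (sum-syntax)

sumℕ-mono : ∀ {n} {f g : Fin n → ℕ} → (∀ i → f i ≤ g i) → ℕΣ.sum f ≤ ℕΣ.sum g
sumℕ-mono = foldr-cong {R = _≤_} {S = _≤_} {f = _+_} {g = _+_} ℕ.+-mono-≤ ℕ.≤-refl

sumℕ-mono-< : ∀ {n} {f g : Fin n → ℕ} (i : Fin n) →
              (∀ j → f j ≤ g j) → f i ℕ.< g i → ℕΣ.sum f ℕ.< ℕΣ.sum g
sumℕ-mono-< {suc n} {f} {g} i f≤g fᵢ<gᵢ = begin-strict
  ℕΣ.sum f                     ≡⟨ ℕΣ.sum-remove f ⟩
  f i + ℕΣ.sum (removeAt f i)  <⟨ ℕ.+-mono-<-≤ fᵢ<gᵢ (sumℕ-mono (f≤g ∘ punchIn i)) ⟩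
  g i + ℕΣ.sum (removeAt g i)  ≡⟨ ℕΣ.sum-remove g ⟨
  ℕΣ.sum g                     ∎
  where open ℕ.≤-Reasoning

∑-const : ∀ n k → ∑[ i < n ] k ≡ n * k
∑-const zero    k = refl
∑-const (suc n) k = cong (_+_ k) (∑-const n k)

sumℚ-mono : ∀ {n} {f g : Fin n → ℚ} → (∀ i → f i ℚ.≤ g i) → sumℚ f ℚ.≤ sumℚ g
sumℚ-mono = foldr-cong {R = ℚ._≤_} {S = ℚ._≤_} {f = ℚ._+_} {g = ℚ._+_} ℚ.+-mono-≤ ℚ.≤-refl

½+[n/2]≡[1+n]/2 : ∀ n → ½ ℚ.+ + n /ℚ 2 ≡ + suc n /ℚ 2
½+[n/2]≡[1+n]/2 n = ℚ.toℚᵘ-injective (begin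
  ℚ.toℚᵘ (½ ℚ.+ + n /ℚ 2)           ≈⟨ ℚ.toℚᵘ-homo-+ ½ (+ n /ℚ 2) ⟩
  ℚ.toℚᵘ ½ ℚᵘ.+ ℚ.toℚᵘ (+ n /ℚ 2)   ≈⟨ ℚᵘ.+-congʳ (ℚ.toℚᵘ ½) (ℚ.toℚᵘ-fromℚᵘ (mkℚᵘ (+ n) 1)) ⟩
  mkℚᵘ (+ 1) 1 ℚᵘ.+ mkℚᵘ (+ n) 1    ≈⟨ *≡* (solve 1 (λ m → (con (+ 1) :* con (+ 2) :+ m :* con (+ 2)) :* con (+ 2)
                                                       := (con (+ 1) :+ m) :* con (+ 4)) refl (+ n)) ⟩
  mkℚᵘ (+ suc n) 1                  ≈⟨ ℚ.toℚᵘ-fromℚᵘ (mkℚᵘ (+ suc n) 1) ⟨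
  ℚ.toℚᵘ (+ suc n /ℚ 2)             ∎)
  where
    open ℚᵘ.≃-Reasoning
    open Data.Integer.Solver.+-*-Solver

∑½≡n/2 : ∀ n → sumℚ {n} (λ _ → ½) ≡ + n /ℚ 2
∑½≡n/2 0       = refl
∑½≡n/2 (suc n) = trans (cong (½ ℚ.+_) (∑½≡n/2 n)) (½+[n/2]≡[1+n]/2 n)

three-halves-bound : ∀ a b c → 1ℚ ℚ.≤ a ℚ.+ b → 1ℚ ℚ.≤ b ℚ.+ c → 1ℚ ℚ.≤ a ℚ.+ c →
               ½ ℚ.+ (½ ℚ.+ (½ ℚ.+ 0ℚ)) ℚ.≤ a ℚ.+ (b ℚ.+ (c ℚ.+ 0ℚ))
three-halves-bound a b c ab bc ac = begin
  ½ ℚ.+ (½ ℚ.+ (½ ℚ.+ 0ℚ))                           ≡⟨⟩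
  (1ℚ ℚ.+ (1ℚ ℚ.+ 1ℚ)) ℚ.* ½                         ≤⟨ ℚ.*-monoʳ-≤-nonNeg ½ (ℚ.+-mono-≤ ab (ℚ.+-mono-≤ bc ac)) ⟩
  ((a ℚ.+ b) ℚ.+ ((b ℚ.+ c) ℚ.+ (a ℚ.+ c))) ℚ.* ½   ≡⟨ solve 3 (λ a b c → ((a :+ b) :+ ((b :+ c) :+ (a :+ c))) :* con ½
                                                                  := a :+ (b :+ (c :+ con 0ℚ))) refl a b c ⟩
  a ℚ.+ (b ℚ.+ (c ℚ.+ 0ℚ))                           ∎
  where
    open ℚ.≤-Reasoning
    open Data.Rational.Solver.+-*-Solver

pair : ∀ {n} → Fin n → Fin n → Subset n
pair x y = ⁅ x ⁆ ∪ ⁅ y ⁆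

x∈pair : ∀ {n} (x y : Fin n) → x ∈ pair x y
x∈pair x y = x∈p∪q⁺ (inj₁ (x∈⁅x⁆ x))

y∈pair : ∀ {n} (x y : Fin n) → y ∈ pair x y
y∈pair x y = x∈p∪q⁺ (inj₂ (x∈⁅x⁆ y))

∈pair⇒≡⊎≡ : ∀ {n} {x y z : Fin n} → z ∈ pair x y → z ≡ x ⊎ z ≡ y
∈pair⇒≡⊎≡ {x = x} {y} z∈ = Sum.map (x∈⁅y⁆⇒x≡y x) (x∈⁅y⁆⇒x≡y y) (x∈p∪q⁻ ⁅ x ⁆ ⁅ y ⁆ z∈)

pair⊆ : ∀ {n} {p : Subset n} {x y} → x ∈ p → y ∈ p → pair x y ⊆ p
pair⊆ {p = p} x∈p y∈p z∈ =
  Sum.[ (λ z≡x → subst (_∈ p) (sym z≡x) x∈p) , (λ z≡y → subst (_∈ p) (sym z≡y) y∈p) ]′ (∈pair⇒≡⊎≡ z∈)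

x∉p⇒lookup≡false : ∀ {n} {p : Subset n} {x} → x ∉ p → lookup p x ≡ false
x∉p⇒lookup≡false {p = p} {x} x∉p with lookup p x in eq
... | true  = contradiction (lookup⇒[]= x p eq) x∉p
... | false = refl

Empty⇒∣p∣≡0 : ∀ {n} {p : Subset n} → Empty p → ∣ p ∣ ≡ 0
Empty⇒∣p∣≡0 {n} empty = trans (cong ∣_∣ (Empty-unique empty)) (∣⊥∣≡0 n)

x∈p∧p⊆⁅x⁆⇒∣p∣≡1 : ∀ {n} {p : Subset n} {x} → x ∈ p → p ⊆ ⁅ x ⁆ → ∣ p ∣ ≡ 1
x∈p∧p⊆⁅x⁆⇒∣p∣≡1 {x = x} x∈p p⊆⁅x⁆ =
  trans (cong ∣_∣ (⊆-antisym p⊆⁅x⁆ ⁅x⁆⊆p)) (∣⁅x⁆∣≡1 x)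
  where
    ⁅x⁆⊆p : ⁅ x ⁆ ⊆ _
    ⁅x⁆⊆p y∈⁅x⁆ = subst (_∈ _) (sym (x∈⁅y⁆⇒x≡y x y∈⁅x⁆)) x∈p

x∈p∧y∈p∧x≢y⇒2≤∣p∣ : ∀ {n} {p : Subset n} {x y} → x ∈ p → y ∈ p → x ≢ y → 2 ≤ ∣ p ∣
x∈p∧y∈p∧x≢y⇒2≤∣p∣ {p = p} {x} {y} x∈p y∈p x≢y = begin-strict
  1           ≡⟨ ∣⁅x⁆∣≡1 y ⟨
  ∣ ⁅ y ⁆ ∣   ≤⟨ p⊆q⇒∣p∣≤∣q∣ ⁅y⁆⊆p-x ⟩
  ∣ p - x ∣   <⟨ x∈p⇒∣p-x∣<∣p∣ x∈p ⟩
  ∣ p ∣       ∎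
  where
    open ℕ.≤-Reasoning
    ⁅y⁆⊆p-x : ⁅ y ⁆ ⊆ p - x
    ⁅y⁆⊆p-x z∈⁅y⁆ = subst (_∈ p - x) (sym (x∈⁅y⁆⇒x≡y y z∈⁅y⁆)) (x∈p∧x≢y⇒x∈p-y y∈p (x≢y ∘ sym))

fibre : ∀ {n k} → (Fin n → Fin k) → Fin k → Subset n
fibre f c = tabulate (λ v → does (f v Fin.≟ c))

∈fibre⁺ : ∀ {n k} (f : Fin n → Fin k) {c v} → f v ≡ c → v ∈ fibre f c
∈fibre⁺ f {c} {v} fv≡c =
  lookup⇒[]= v (fibre f c) (trans (lookup∘tabulate _ v) (dec-true (f v Fin.≟ c) fv≡c))

∈fibre⁻ : ∀ {n k} (f : Fin n → Fin k) {c v} → v ∈ fibre f c → f v ≡ c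
∈fibre⁻ f {c} {v} v∈ with f v Fin.≟ c | trans (sym (lookup∘tabulate _ v)) ([]=⇒lookup v∈)
... | yes fv≡c | _ = fv≡c

fibres-disjoint : ∀ {n k} {f : Fin n → Fin k} {c c′} → c ≢ c′ → Empty (fibre f c ∩ fibre f c′)
fibres-disjoint {f = f} {c} {c′} c≢c′ (v , v∈) =
  let v∈c , v∈c′ = x∈p∩q⁻ (fibre f c) (fibre f c′) v∈ in c≢c′ (trans (sym (∈fibre⁻ f v∈c)) (∈fibre⁻ f v∈c′))

bit : Bool → ℕ
bit true  = 1
bit false = 0

∣p∣≡∑bit : ∀ {n} (p : Subset n) → ∣ p ∣ ≡ ∑[ i < n ] bit (lookup p i)
∣p∣≡∑bit []          = refl
∣p∣≡∑bit (true ∷ p)  = cong suc (∣p∣≡∑bit p)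
∣p∣≡∑bit (false ∷ p) = ∣p∣≡∑bit p

avoid-two-unique : ∀ (u w r a : Fin 3) → u ≢ w → r ≢ u → r ≢ w → a ≢ u → a ≢ w → r ≡ a
avoid-two-unique = from-yes
  (all? λ (u : Fin 3) → all? λ (w : Fin 3) → all? λ (r : Fin 3) → all? λ (a : Fin 3) →
     ¬? (u Fin.≟ w) →-dec ¬? (r Fin.≟ u) →-dec ¬? (r Fin.≟ w) →-dec
     ¬? (a Fin.≟ u) →-dec ¬? (a Fin.≟ w) →-dec r Fin.≟ a)

two-of-three : ∀ (f : Fin 3 → Bool) → (∀ {u w} → u ≢ w → T (f u ∨ f w)) → 2 ≤ ∑[ r < 3 ] bit (f r)
two-of-three f hits
  with f 0F | f 1F | f 2F | hits {0F} {1F} (λ ()) | hits {1F} {2F} (λ ()) | hits {0F} {2F} (λ ())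
... | true  | true  | _     | _ | _ | _ = ℕ.s≤s (ℕ.s≤s ℕ.z≤n)
... | true  | false | true  | _ | _ | _ = ℕ.s≤s (ℕ.s≤s ℕ.z≤n)
... | false | true  | true  | _ | _ | _ = ℕ.s≤s (ℕ.s≤s ℕ.z≤n)

sumOver-mono-⊆ : ∀ {n} {p q : Subset n} {x : Fin n → ℚ} →
                 (∀ v → 0ℚ ℚ.≤ x v) → p ⊆ q → sumOver p x ℚ.≤ sumOver q x
sumOver-mono-⊆ {p = p} {q} {x} x≥0 p⊆q = sumℚ-mono pointwise
  where
    pointwise : ∀ v → (if lookup p v then x v else 0ℚ) ℚ.≤ (if lookup q v then x v else 0ℚ)
    pointwise v with lookup p v in v∈p | lookup q v in v∈q
    ... | true  | true  = ℚ.≤-refl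
    ... | true  | false = contradiction (trans (sym ([]=⇒lookup (p⊆q (lookup⇒[]= v p v∈p)))) v∈q) λ ()
    ... | false | true  = x≥0 v
    ... | false | false = ℚ.≤-refl

sumOver-pair : ∀ {n} {x y : Fin n} (f : Fin n → ℚ) → x ≢ y → sumOver (pair x y) f ≡ f x ℚ.+ f y
sumOver-pair {x = x} {y} f x≢y =
  trans (sum-pair ℚ.+-0-commutativeMonoid x≢y vanish)
        (cong₂ ℚ._+_ (selects (x∈pair x y)) (selects (y∈pair x y)))
  where
    selects : ∀ {v} → v ∈ pair x y → (if lookup (pair x y) v then f v else 0ℚ) ≡ f v
    selects {v} v∈ = cong (λ b → if b then f v else 0ℚ) ([]=⇒lookup v∈)
    vanish : ∀ v → v ≢ x → v ≢ y → (if lookup (pair x y) v then f v else 0ℚ) ≡ 0ℚ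
    vanish v v≢x v≢y = cong (λ b → if b then f v else 0ℚ)
      (x∉p⇒lookup≡false (Sum.[ v≢x , v≢y ] ∘ ∈pair⇒≡⊎≡))

-- Forts and zero forcing in an arbitrary graph

module _ {n} (G : Graph n) where

  ∈N⁺ : ∀ {v x} → Adj G v x → x ∈ N G v
  ∈N⁺ {v} {x} v~x = lookup⇒[]= x (N G v) (trans (lookup∘tabulate (adj G v) x) v~x)

  ∈N⁻ : ∀ {v x} → x ∈ N G v → Adj G v x
  ∈N⁻ {v} {x} x∈N = trans (sym (lookup∘tabulate (adj G v) x)) ([]=⇒lookup x∈N)

  two-neighbours-in : ∀ {F} v {x y} → Adj G v x → x ∈ F → Adj G v y → y ∈ F → x ≢ y →
                      ∣ N G v ∩ F ∣ ≢ 1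
  two-neighbours-in v v~x x∈F v~y y∈F x≢y ∣N∩F∣≡1 = ℕ.<-irrefl (sym ∣N∩F∣≡1)
    (x∈p∧y∈p∧x≢y⇒2≤∣p∣ (x∈p∩q⁺ (∈N⁺ v~x , x∈F)) (x∈p∩q⁺ (∈N⁺ v~y , y∈F)) x≢y)

  no-neighbour-in : ∀ F v → (∀ {x} → Adj G v x → x ∉ F) → ∣ N G v ∩ F ∣ ≢ 1
  no-neighbour-in F v none ∣N∩F∣≡1 = ℕ.0≢1+n (trans (sym (Empty⇒∣p∣≡0 empty)) ∣N∩F∣≡1)
    where
      empty : Empty (N G v ∩ F)
      empty (x , x∈N∩F) = let x∈N , x∈F = x∈p∩q⁻ (N G v) F x∈N∩F in none (∈N⁻ x∈N) x∈F

  fort-no-unique-neighbour : ∀ {F} v {w} → IsFort G F → v ∉ F → Adj G v w → w ∈ F →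
                             (∀ {x} → Adj G v x → x ∈ F → x ≡ w) → ⊥
  fort-no-unique-neighbour {F} v {w} (_ , outside) v∉F v~w w∈F unique =
    outside v v∉F (x∈p∧p⊆⁅x⁆⇒∣p∣≡1 (x∈p∩q⁺ (∈N⁺ v~w , w∈F)) N∩F⊆⁅w⁆)
    where
      N∩F⊆⁅w⁆ : N G v ∩ F ⊆ ⁅ w ⁆
      N∩F⊆⁅w⁆ {x} x∈N∩F = let x∈N , x∈F = x∈p∩q⁻ (N G v) F x∈N∩F in
        subst (_∈ ⁅ w ⁆) (sym (unique (∈N⁻ x∈N) x∈F)) (x∈⁅x⁆ w)

  filled-outside-fort : ∀ {B F} → IsFort G F → (∀ {v} → v ∈ F → v ∉ B) →
                        ∀ {v} → Filled G B v → v ∉ F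
  filled-outside-fort fort F∩B≡∅ (initial v∈B) v∈F = F∩B≡∅ v∈F v∈B
  filled-outside-fort {F = F} fort F∩B≡∅ (force {u} {w} u~w u-filled others) w∈F =
    fort-no-unique-neighbour u fort (filled-outside-fort fort F∩B≡∅ u-filled) u~w w∈F unique
    where
      unique : ∀ {x} → Adj G u x → x ∈ F → x ≡ w
      unique {x} u~x x∈F with x Fin.≟ w
      ... | yes x≡w = x≡w
      ... | no  x≢w = contradiction x∈F (filled-outside-fort fort F∩B≡∅ (others x u~x x≢w))

  zero-forcing-set-meets-fort : ∀ {B F} → IsZeroForcingSet G B → IsFort G F →
                                ¬ (∀ {v} → v ∈ F → v ∉ B)
  zero-forcing-set-meets-fort zfs fort@((v , v∈F) , _) F∩B≡∅ =
    filled-outside-fort fort F∩B≡∅ (zfs v) v∈F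

-- The graph s K₃ ∨ K₁

module Triangles (s : ℕ) where

  order : ℕ
  order = suc (3 * s)

  G : Graph order
  G = sK3∨K1 s

  V : Set
  V = Fin order

  slot : Fin s → Fin 3 → Fin (3 * s)
  slot t r = cast (ℕ.*-comm s 3) (combine t r)

  split : Fin (3 * s) → Fin s × Fin 3
  split i = remQuot 3 (cast (ℕ.*-comm 3 s) i)

  split-slot : ∀ t r → split (slot t r) ≡ (t , r)
  split-slot t r = trans (cong (remQuot 3) (cast-involutive (ℕ.*-comm 3 s) (ℕ.*-comm s 3) (combine t r)))
                         (remQuot-combine t r)

  slot-split : ∀ i → uncurry slot (split i) ≡ i
  slot-split i = trans (cong (cast (ℕ.*-comm s 3)) (combine-remQuot {s} 3 (cast (ℕ.*-comm 3 s) i)))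
                      (cast-involutive (ℕ.*-comm s 3) (ℕ.*-comm 3 s) i)

  slot-injective : ∀ {t r t′ r′} → slot t r ≡ slot t′ r′ → t ≡ t′ × r ≡ r′
  slot-injective {t} {r} {t′} {r′} eq =
    ×-≡,≡←≡ (trans (sym (split-slot t r)) (trans (cong split eq) (split-slot t′ r′)))

  sum-by-triangle : ∀ {c ℓ} (M : Monoid c ℓ) (f : Vector (Monoid.Carrier M) (3 * s)) →
                    Monoid._≈_ M (MonoidSum.sum M f) (MonoidSum.sum M λ t → MonoidSum.sum M λ r → f (slot t r))
  sum-by-triangle M f = Monoid.trans M (Monoid.reflexive M (sym (sum-cast M (ℕ.*-comm s 3) f)))
                                       (sum-combine M s (f ∘ cast (ℕ.*-comm s 3)))

  toℕ-slot : ∀ t r → toℕ (slot t r) ≡ 3 * toℕ t + toℕ r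
  toℕ-slot t r = trans (toℕ-cast _ (combine t r)) (toℕ-combine t r)

  toℕ-slot/3 : ∀ t r → toℕ (slot t r) / 3 ≡ toℕ t
  toℕ-slot/3 t r = begin
    toℕ (slot t r) / 3               ≡⟨ cong (_/ 3) (toℕ-slot t r) ⟩
    (3 * toℕ t + toℕ r) / 3          ≡⟨ +-distrib-/-∣ˡ (toℕ r) (m∣m*n (toℕ t)) ⟩
    3 * toℕ t / 3 + toℕ r / 3        ≡⟨ cong₂ _+_ (trans (cong (_/ 3) (ℕ.*-comm 3 (toℕ t))) (m*n/n≡m (toℕ t) 3))
                                                (m<n⇒m/n≡0 (toℕ<n r)) ⟩
    toℕ t + 0                        ≡⟨ ℕ.+-identityʳ (toℕ t) ⟩
    toℕ t                            ∎
    where open ≡-Reasoning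

  pattern apex = zero

  corner : Fin s → Fin 3 → V
  corner t r = suc (slot t r)

  corner-injective : ∀ {t r t′ r′} → corner t r ≡ corner t′ r′ → t ≡ t′ × r ≡ r′
  corner-injective = slot-injective ∘ suc-injective

  data Position : V → Set where
    at-apex   : Position apex
    at-corner : ∀ t r → Position (corner t r)

  position : ∀ v → Position v
  position zero    = at-apex
  position (suc i) = subst (Position ∘ suc) (slot-split i) (at-corner _ _)

  -- sK3∨K1-adj on two non-apex vertices has this shape.
  private
    ≡ᵇ-shape⇒≢×≡ : ∀ {m n p q : ℕ} → (not (m ℕ.≡ᵇ n) ∧ (p ℕ.≡ᵇ q)) ≡ true → m ≢ n × p ≡ q
    ≡ᵇ-shape⇒≢×≡ {m} {n} {p} {q} b with m ℕ.≡ᵇ n in m≡ᵇn | p ℕ.≡ᵇ q in p≡ᵇq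
    ... | false | true = (λ m≡n → subst T m≡ᵇn (ℕ.≡⇒≡ᵇ m n m≡n)) , ℕ.≡ᵇ⇒≡ p q (subst T (sym p≡ᵇq) _)

    ≢×≡⇒≡ᵇ-shape : ∀ {m n p q : ℕ} → m ≢ n → p ≡ q → (not (m ℕ.≡ᵇ n) ∧ (p ℕ.≡ᵇ q)) ≡ true
    ≢×≡⇒≡ᵇ-shape {m} {n} {p} {q} m≢n p≡q with m ℕ.≡ᵇ n in m≡ᵇn | p ℕ.≡ᵇ q in p≡ᵇq
    ... | false | true  = refl
    ... | true  | _     = contradiction (ℕ.≡ᵇ⇒≡ m n (subst T (sym m≡ᵇn) _)) m≢n
    ... | false | false = contradiction (subst T p≡ᵇq (ℕ.≡⇒≡ᵇ p q p≡q)) λ ()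

  corner~corner⁺ : ∀ {t r r′} → r ≢ r′ → Adj G (corner t r) (corner t r′)
  corner~corner⁺ {t} {r} {r′} r≢r′ =
    ≢×≡⇒≡ᵇ-shape (r≢r′ ∘ proj₂ ∘ slot-injective ∘ toℕ-injective) (trans (toℕ-slot/3 t r) (sym (toℕ-slot/3 t r′)))

  corner~corner⁻ : ∀ {t r t′ r′} → Adj G (corner t r) (corner t′ r′) → t ≡ t′ × r ≢ r′
  corner~corner⁻ {t} {r} {t′} {r′} t,r~t′,r′ with ≡ᵇ-shape⇒≢×≡ t,r~t′,r′
  ... | slots≢ , same-triangle = t≡t′ , λ r≡r′ → slots≢ (cong toℕ (cong₂ slot t≡t′ r≡r′))
    where
      t≡t′ : t ≡ t′
      t≡t′ = toℕ-injective (trans (sym (toℕ-slot/3 t r)) (trans same-triangle (toℕ-slot/3 t′ r′)))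

  corner≢corner : ∀ {t a b} → a ≢ b → corner t a ≢ corner t b
  corner≢corner a≢b = a≢b ∘ proj₂ ∘ corner-injective

  edge : Fin s → Fin 3 → Fin 3 → Subset order
  edge t a b = pair (corner t a) (corner t b)

  edge-isFort : ∀ {t a b} → a ≢ b → IsFort G (edge t a b)
  edge-isFort {t} {a} {b} a≢b = (corner t a , a∈E) , outside
    where
      a∈E : corner t a ∈ edge t a b
      a∈E = x∈pair (corner t a) (corner t b)
      b∈E : corner t b ∈ edge t a b
      b∈E = y∈pair (corner t a) (corner t b)

      outside : ∀ v → v ∉ edge t a b → ∣ N G v ∩ edge t a b ∣ ≢ 1
      outside v v∉E with position v
      ... | at-apex = two-neighbours-in G apex refl a∈E refl b∈E (corner≢corner a≢b)
      ... | at-corner t′ c with t′ Fin.≟ t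
      ...   | yes refl = two-neighbours-in G (corner t c) (corner~corner⁺ c≢a) a∈E
                                                          (corner~corner⁺ c≢b) b∈E (corner≢corner a≢b)
        where
          c≢a : c ≢ a
          c≢a refl = v∉E a∈E
          c≢b : c ≢ b
          c≢b refl = v∉E b∈E
      ...   | no t′≢t = no-neighbour-in G (edge t a b) (corner t′ c) λ c~x x∈E →
                          Sum.[ other-triangle c~x , other-triangle c~x ] (∈pair⇒≡⊎≡ x∈E)
        where
          other-triangle : ∀ {x r} → Adj G (corner t′ c) x → x ≢ corner t r
          other-triangle c~x refl = t′≢t (proj₁ (corner~corner⁻ c~x))

  fort⊆edge⇒other-corner : ∀ {F t a b} → IsFort G F →
                           (∀ {x} → x ∈ F → x ≡ corner t a ⊎ x ≡ corner t b) →
                           a ≢ b → corner t a ∈ F → corner t b ∈ F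
  fort⊆edge⇒other-corner {F} {t} {a} {b} fort F⊆E a≢b a∈F with corner t b ∈? F
  ... | yes b∈F = b∈F
  ... | no  b∉F =
    ⊥-elim (fort-no-unique-neighbour G (corner t b) fort b∉F (corner~corner⁺ (a≢b ∘ sym)) a∈F unique)
    where
      unique : ∀ {x} → Adj G (corner t b) x → x ∈ F → x ≡ corner t a
      unique _ x∈F = Sum.[ id , (λ x≡b → contradiction (subst (_∈ F) x≡b x∈F) b∉F) ]′ (F⊆E x∈F)

  edge-isMinimalFort : ∀ {t a b} → a ≢ b → IsMinimalFort G (edge t a b)
  edge-isMinimalFort {t} {a} {b} a≢b = edge-isFort a≢b , minimal
    where
      minimal : ∀ F → IsFort G F → F ⊆ edge t a b → edge t a b ⊆ F
      minimal F fort@((z , z∈F) , _) F⊆E = pair⊆ a∈F (fort⊆edge⇒other-corner fort inside a≢b a∈F)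
        where
          inside : ∀ {y} → y ∈ F → y ≡ corner t a ⊎ y ≡ corner t b
          inside = ∈pair⇒≡⊎≡ ∘ F⊆E
          a∈F : corner t a ∈ F
          a∈F = Sum.[ (λ z≡a → subst (_∈ F) z≡a z∈F) ,
                      (λ z≡b → fort⊆edge⇒other-corner fort (Sum.swap ∘ inside) (a≢b ∘ sym)
                                 (subst (_∈ F) z≡b z∈F)) ]′
                    (inside z∈F)

  apex+transversal-isFort : ∀ {F} → apex ∈ F → (∀ t → ∃ λ r → corner t r ∈ F) → IsFort G F
  apex+transversal-isFort {F} apex∈F transversal = (apex , apex∈F) , outside
    where
      outside : ∀ v → v ∉ F → ∣ N G v ∩ F ∣ ≢ 1
      outside v v∉F with position v
      ... | at-apex = contradiction apex∈F v∉F
      ... | at-corner t r with transversal t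
      ...   | m , m∈F = two-neighbours-in G (corner t r) refl apex∈F (corner~corner⁺ r≢m) m∈F λ ()
        where
          r≢m : r ≢ m
          r≢m refl = v∉F m∈F

  fort∋apex⇒transversal : ∀ {F} → IsFort G F → apex ∈ F → ∀ t → ∃ λ r → corner t r ∈ F
  fort∋apex⇒transversal {F} fort apex∈F t with any? (λ r → corner t r ∈? F)
  ... | yes found = found
  ... | no  none  = ⊥-elim (fort-no-unique-neighbour G (corner t 0F) fort (none ∘ (0F ,_)) refl apex∈F unique)
    where
      unique : ∀ {x} → Adj G (corner t 0F) x → x ∈ F → x ≡ apex
      unique {x} t~x x∈F with position x
      ... | at-apex = refl
      ... | at-corner t′ r with corner~corner⁻ t~x
      ...   | refl , _ = ⊥-elim (none (r , x∈F))

  apex∉fort⇒meets-edges : ∀ {F t a u w} → IsFort G F → apex ∉ F → corner t a ∈ F → u ≢ w →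
                          corner t u ∈ F ⊎ corner t w ∈ F
  apex∉fort⇒meets-edges {F} {t} {a} {u} {w} fort apex∉F a∈F u≢w with corner t u ∈? F | corner t w ∈? F
  ... | yes u∈F | _       = inj₁ u∈F
  ... | no _    | yes w∈F = inj₂ w∈F
  ... | no u∉F  | no w∉F  =
    ⊥-elim (fort-no-unique-neighbour G (corner t u) fort u∉F (corner~corner⁺ u≢a) a∈F unique)
    where
      u≢a : u ≢ a
      u≢a refl = u∉F a∈F
      w≢a : w ≢ a
      w≢a refl = w∉F a∈F
      unique : ∀ {x} → Adj G (corner t u) x → x ∈ F → x ≡ corner t a
      unique {x} u~x x∈F with position x
      ... | at-apex = contradiction x∈F apex∉F
      ... | at-corner t′ r with corner~corner⁻ u~x
      ...   | refl , u≢r =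
        cong (corner t) (avoid-two-unique u w r a u≢w (u≢r ∘ sym) r≢w (u≢a ∘ sym) (w≢a ∘ sym))
        where
          r≢w : r ≢ w
          r≢w refl = w∉F x∈F

  apex∉fort⇒second-corner : ∀ {F t a} → IsFort G F → apex ∉ F → corner t a ∈ F →
                            ∃ λ b → b ≢ a × corner t b ∈ F
  apex∉fort⇒second-corner {a = a} fort apex∉F a∈F =
    Sum.[ (λ b∈F → punchIn a 0F , punchInᵢ≢i a 0F , b∈F) , (λ b∈F → punchIn a 1F , punchInᵢ≢i a 1F , b∈F) ]′
      (apex∉fort⇒meets-edges fort apex∉F a∈F ((λ ()) ∘ punchIn-injective a 0F 1F))

  -- The fort number

  data Anchor (F : Subset order) : Set where
    via-apex   : apex ∈ F → Anchor F
    via-corner : ∀ t a → apex ∉ F → corner t a ∈ F → Anchor F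

  anchor : ∀ {F} → IsFort G F → Anchor F
  anchor {F} ((v , v∈F) , _) with apex ∈? F
  ... | yes apex∈F = via-apex apex∈F
  ... | no  apex∉F with position v
  ...   | at-apex       = contradiction v∈F apex∉F
  ...   | at-corner t a = via-corner t a apex∉F v∈F

  label : ∀ {F} → Anchor F → Fin (suc s)
  label (via-apex _)         = zero
  label (via-corner t _ _ _) = suc t

  same-label⇒meet : ∀ {F F′} → IsFort G F → IsFort G F′ → (α : Anchor F) (β : Anchor F′) →
                    label α ≡ label β → Nonempty (F ∩ F′)
  same-label⇒meet _ _ (via-apex apex∈F) (via-apex apex∈F′) _ = apex , x∈p∩q⁺ (apex∈F , apex∈F′)
  same-label⇒meet fort fort′ (via-corner t a apex∉F a∈F) (via-corner t b apex∉F′ b∈F′) refl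
    with apex∉fort⇒second-corner fort′ apex∉F′ b∈F′
  ... | b′ , b′≢b , b′∈F′ =
    Sum.[ (λ b∈F → corner t b , x∈p∩q⁺ (b∈F , b∈F′)) , (λ b′∈F → corner t b′ , x∈p∩q⁺ (b′∈F , b′∈F′)) ]′
      (apex∉fort⇒meets-edges fort apex∉F a∈F (b′≢b ∘ sym))

  disjoint-forts-≤ : ∀ m (Fs : Fin m → Subset order) → DisjointForts G m Fs → m ≤ suc s
  disjoint-forts-≤ m Fs (forts , disjoint) = injective⇒≤ labels-injective
    where
      labels-injective : ∀ {i j} → label (anchor (forts i)) ≡ label (anchor (forts j)) → i ≡ j
      labels-injective {i} {j} same with i Fin.≟ j
      ... | yes i≡j = i≡j
      ... | no  i≢j = ⊥-elim (disjoint i j i≢j (same-label⇒meet (forts i) (forts j) _ _ same))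

  corner-colour : Fin s → Fin 3 → Fin (suc s)
  corner-colour t 0F      = zero
  corner-colour t (suc _) = suc t

  colour : V → Fin (suc s)
  colour apex    = zero
  colour (suc i) = uncurry corner-colour (split i)

  colour-corner : ∀ t r → colour (corner t r) ≡ corner-colour t r
  colour-corner t r = cong (uncurry corner-colour) (split-slot t r)

  colour-class-edge : ∀ t → fibre colour (suc t) ≡ edge t 1F 2F
  colour-class-edge t = ⊆-antisym class⊆edge edge⊆class
    where
      coloured⇒∈edge : ∀ {t′ r} → corner-colour t′ r ≡ suc t → corner t′ r ∈ edge t 1F 2F
      coloured⇒∈edge {r = 1F} refl = x∈pair (corner t 1F) (corner t 2F)
      coloured⇒∈edge {r = 2F} refl = y∈pair (corner t 1F) (corner t 2F)

      class⊆edge : fibre colour (suc t) ⊆ edge t 1F 2F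
      class⊆edge {v} v∈ with position v | ∈fibre⁻ colour v∈
      ... | at-corner t′ r | coloured = coloured⇒∈edge (trans (sym (colour-corner t′ r)) coloured)

      edge⊆class : edge t 1F 2F ⊆ fibre colour (suc t)
      edge⊆class v∈ = Sum.[ (λ v≡ → ∈fibre⁺ colour (trans (cong colour v≡) (colour-corner t 1F))) ,
                            (λ v≡ → ∈fibre⁺ colour (trans (cong colour v≡) (colour-corner t 2F))) ]′
                          (∈pair⇒≡⊎≡ v∈)

  colour-class-isFort : ∀ c → IsFort G (fibre colour c)
  colour-class-isFort zero    =
    apex+transversal-isFort (∈fibre⁺ colour refl) λ t → 0F , ∈fibre⁺ colour (colour-corner t 0F)
  colour-class-isFort (suc t) = subst (IsFort G) (sym (colour-class-edge t)) (edge-isFort λ ())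

  fort-number : FortNumberIs G (suc s)
  fort-number = (fibre colour , colour-class-isFort , λ _ _ → fibres-disjoint {f = colour}) , disjoint-forts-≤

  -- The fractional zero forcing number

  two-triangles : 2 ≤ s → ∃₂ λ (t₀ t₁ : Fin s) → t₀ ≢ t₁
  two-triangles 2≤s = inject≤ 0F 2≤s , inject≤ 1F 2≤s , (λ ()) ∘ inject≤-injective 2≤s 2≤s 0F 1F

  fort-has-two-corners : 2 ≤ s → ∀ {F} → IsFort G F → ∃₂ λ i j → i ≢ j × suc i ∈ F × suc j ∈ F
  fort-has-two-corners 2≤s fort with anchor fort | two-triangles 2≤s
  ... | via-apex apex∈F | t₀ , t₁ , t₀≢t₁ =
    let r₀ , r₀∈F = fort∋apex⇒transversal fort apex∈F t₀
        r₁ , r₁∈F = fort∋apex⇒transversal fort apex∈F t₁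
    in slot t₀ r₀ , slot t₁ r₁ , t₀≢t₁ ∘ proj₁ ∘ slot-injective , r₀∈F , r₁∈F
  ... | via-corner t a apex∉F a∈F | _ =
    let b , b≢a , b∈F = apex∉fort⇒second-corner fort apex∉F a∈F
    in slot t a , slot t b , b≢a ∘ sym ∘ proj₂ ∘ slot-injective , a∈F , b∈F

  half-off-apex : V → ℚ
  half-off-apex apex    = 0ℚ
  half-off-apex (suc _) = ½

  half-off-apex-nonneg : ∀ v → 0ℚ ℚ.≤ half-off-apex v
  half-off-apex-nonneg apex    = ℚ.≤-refl
  half-off-apex-nonneg (suc _) = ℚ.≤ᵇ⇒≤ _

  half-off-apex-feasible : 2 ≤ s → FeasibleZStar G half-off-apex
  half-off-apex-feasible 2≤s = half-off-apex-nonneg , covers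
    where
      covers : ∀ F → IsMinimalFort G F → 1ℚ ℚ.≤ sumOver F half-off-apex
      covers F (fort , _) with fort-has-two-corners 2≤s fort
      ... | i , j , i≢j , i∈F , j∈F = begin
        1ℚ                                             ≡⟨ sumOver-pair half-off-apex (i≢j ∘ suc-injective) ⟨
        sumOver (pair (suc i) (suc j)) half-off-apex   ≤⟨ sumOver-mono-⊆ half-off-apex-nonneg (pair⊆ i∈F j∈F) ⟩
        sumOver F half-off-apex                        ∎
        where open ℚ.≤-Reasoning

  sum-half-off-apex : sumℚ half-off-apex ≡ + (3 * s) /ℚ 2
  sum-half-off-apex = trans (ℚ.+-identityˡ _) (∑½≡n/2 (3 * s))

  edge-constraint : ∀ {x t a b} → FeasibleZStar G x → a ≢ b → 1ℚ ℚ.≤ x (corner t a) ℚ.+ x (corner t b)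
  edge-constraint {x} {t} {a} {b} (_ , covers) a≢b =
    subst (1ℚ ℚ.≤_) (sumOver-pair x (corner≢corner a≢b)) (covers (edge t a b) (edge-isMinimalFort a≢b))

  half-off-apex-optimal : ∀ x → FeasibleZStar G x → sumℚ half-off-apex ℚ.≤ sumℚ x
  half-off-apex-optimal x feasible@(x≥0 , _) = ℚ.+-mono-≤ (x≥0 apex) (begin
    sumℚ {3 * s} (λ _ → ½)                            ≡⟨ sum-by-triangle ℚ.+-0-monoid (λ _ → ½) ⟩
    sumℚ {s} (λ t → sumℚ {3} λ _ → ½)                  ≤⟨ sumℚ-mono triangle-bound ⟩
    sumℚ {s} (λ t → sumℚ λ r → x (corner t r))         ≡⟨ sum-by-triangle ℚ.+-0-monoid (x ∘ suc) ⟨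
    sumℚ (x ∘ suc)                                     ∎)
    where
      open ℚ.≤-Reasoning
      triangle-bound : ∀ t → sumℚ {3} (λ _ → ½) ℚ.≤ sumℚ λ r → x (corner t r)
      triangle-bound t = three-halves-bound (x (corner t 0F)) (x (corner t 1F)) (x (corner t 2F))
                                      (edge-constraint {x} {t} {0F} {1F} feasible λ ())
                                      (edge-constraint {x} {t} {1F} {2F} feasible λ ())
                                      (edge-constraint {x} {t} {0F} {2F} feasible λ ())

  fractional-zero-forcing-number : 2 ≤ s → ZStarIs G (+ (3 * s) /ℚ 2)
  fractional-zero-forcing-number 2≤s =
    (half-off-apex , half-off-apex-feasible 2≤s , sum-half-off-apex) ,
    λ x feasible → subst (ℚ._≤ sumℚ x) sum-half-off-apex (half-off-apex-optimal x feasible)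

  -- The zero forcing number

  triangle-count : Subset order → Fin s → ℕ
  triangle-count B t = ∑[ r < 3 ] bit (lookup B (corner t r))

  ∣B∣≡apex+triangles : ∀ B → ∣ B ∣ ≡ bit (lookup B apex) + ∑[ t < s ] triangle-count B t
  ∣B∣≡apex+triangles B =
    trans (∣p∣≡∑bit B) (cong (_+_ (bit (lookup B apex))) (sum-by-triangle ℕ.+-0-monoid (bit ∘ lookup B ∘ suc)))

  zero-forcing-set-meets-edges : ∀ {B t u w} → IsZeroForcingSet G B → u ≢ w →
                                 corner t u ∈ B ⊎ corner t w ∈ B
  zero-forcing-set-meets-edges {B} {t} {u} {w} zfs u≢w with corner t u ∈? B | corner t w ∈? B
  ... | yes u∈B | _       = inj₁ u∈B
  ... | no _    | yes w∈B = inj₂ w∈B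
  ... | no u∉B  | no w∉B  = ⊥-elim (zero-forcing-set-meets-fort G zfs (edge-isFort u≢w) λ x∈E →
    Sum.[ (λ x≡u → subst (_∉ B) (sym x≡u) u∉B) , (λ x≡w → subst (_∉ B) (sym x≡w) w∉B) ]′ (∈pair⇒≡⊎≡ x∈E))

  zero-forcing-set-triangle-count : ∀ {B} → IsZeroForcingSet G B → ∀ t → 2 ≤ triangle-count B t
  zero-forcing-set-triangle-count {B} zfs t =
    two-of-three (λ r → lookup B (corner t r))
      λ u≢w → Equivalence.from T-∨ (Sum.map ∈⇒T ∈⇒T (zero-forcing-set-meets-edges zfs u≢w))
    where
      ∈⇒T : ∀ {x} → x ∈ B → T (lookup B x)
      ∈⇒T x∈B = Equivalence.from T-≡ ([]=⇒lookup x∈B)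

  zero-forcing-set-without-apex : ∀ {B} → IsZeroForcingSet G B → apex ∉ B → ∃ λ t → ∀ r → corner t r ∈ B
  zero-forcing-set-without-apex {B} zfs apex∉B with any? (λ t → all? λ r → corner t r ∈? B)
  ... | yes triangle⊆B = triangle⊆B
  ... | no  none       = ⊥-elim (zero-forcing-set-meets-fort G zfs complement-isFort x∈∁p⇒x∉p)
    where
      complement-isFort : IsFort G (∁ B)
      complement-isFort = apex+transversal-isFort (x∉p⇒x∈∁p apex∉B) λ t →
        let r , r∉B = ¬∀⟶∃¬ 3 _ (λ r → corner t r ∈? B) (none ∘ (t ,_)) in r , x∉p⇒x∈∁p r∉B

  zero-forcing-set-size : ∀ {B} → IsZeroForcingSet G B → suc (s * 2) ≤ ∣ B ∣
  zero-forcing-set-size {B} zfs = subst (suc (s * 2) ≤_) (sym (∣B∣≡apex+triangles B)) bound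
    where
      open ℕ.≤-Reasoning
      counts : ℕ
      counts = ∑[ t < s ] triangle-count B t
      2s≤counts : s * 2 ≤ counts
      2s≤counts = subst (_≤ counts) (∑-const s 2) (sumℕ-mono (zero-forcing-set-triangle-count zfs))

      bound : suc (s * 2) ≤ bit (lookup B apex) + counts
      bound with apex ∈? B
      ... | yes apex∈B = subst (λ b → suc (s * 2) ≤ bit b + counts) (sym ([]=⇒lookup apex∈B)) (ℕ.s≤s 2s≤counts)
      ... | no  apex∉B with zero-forcing-set-without-apex zfs apex∉B
      ...   | t , triangle⊆B = begin-strict
        s * 2                          ≡⟨ ∑-const s 2 ⟨
        ∑[ t < s ] 2                   <⟨ sumℕ-mono-< t (zero-forcing-set-triangle-count zfs) (ℕ.≤-reflexive 3≡count) ⟩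
        counts                         ≤⟨ ℕ.m≤n+m counts (bit (lookup B apex)) ⟩
        bit (lookup B apex) + counts   ∎
        where
          3≡count : 3 ≡ triangle-count B t
          3≡count = sym (ℕΣ.sum-cong-≗ (λ r → cong bit ([]=⇒lookup (triangle⊆B r))))

  not-top : Fin 3 → Bool
  not-top 2F = false
  not-top _  = true

  in-B₀ : V → Bool
  in-B₀ apex    = true
  in-B₀ (suc i) = not-top (proj₂ (split i))

  B₀ : Subset order
  B₀ = tabulate in-B₀

  lookup-B₀-corner : ∀ t r → lookup B₀ (corner t r) ≡ not-top r
  lookup-B₀-corner t r = trans (lookup∘tabulate in-B₀ (corner t r)) (cong (not-top ∘ proj₂) (split-slot t r))

  corner∈B₀ : ∀ {t r} → not-top r ≡ true → corner t r ∈ B₀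
  corner∈B₀ {t} {r} not-top-r = lookup⇒[]= (corner t r) B₀ (trans (lookup-B₀-corner t r) not-top-r)

  B₀-zero-forcing : IsZeroForcingSet G B₀
  B₀-zero-forcing v with position v
  ... | at-apex        = initial here
  ... | at-corner t 0F = initial (corner∈B₀ refl)
  ... | at-corner t 1F = initial (corner∈B₀ refl)
  ... | at-corner t 2F = force (corner~corner⁺ λ ()) (initial (corner∈B₀ refl)) others
    where
      others : ∀ x → Adj G (corner t 0F) x → x ≢ corner t 2F → Filled G B₀ x
      others x t~x x≢top with position x
      ... | at-apex = initial here
      ... | at-corner t′ r with corner~corner⁻ t~x
      ...   | refl , _ with r
      ...     | 0F = initial (corner∈B₀ refl)
      ...     | 1F = initial (corner∈B₀ refl)
      ...     | 2F = contradiction refl x≢top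

  ∣B₀∣ : ∣ B₀ ∣ ≡ suc (s * 2)
  ∣B₀∣ = trans (∣B∣≡apex+triangles B₀)
               (cong suc (trans (ℕΣ.sum-cong-≗ λ t → ℕΣ.sum-cong-≗ λ r → cong bit (lookup-B₀-corner t r))
                                (∑-const s 2)))

  zero-forcing-number : ZeroForcingNumberIs G (suc (s * 2))
  zero-forcing-number = (B₀ , B₀-zero-forcing , ∣B₀∣) , λ _ → zero-forcing-set-size

3*n/3+1≡1+n : ∀ n → 3 * n / 3 + 1 ≡ suc n
3*n/3+1≡1+n n = trans (cong (_+ 1) (trans (cong (_/ 3) (ℕ.*-comm 3 n)) (m*n/n≡m n 3))) (ℕ.+-comm n 1)

proposition3p14 : (s : ℕ) → 2 ≤ s →
    FortNumberIs (sK3∨K1 s) ((suc (3 * s) ∸ 1) / 3 + 1) ×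
    ZStarIs (sK3∨K1 s) ((+ (suc (3 * s) ∸ 1)) /ℚ 2) ×
    ZeroForcingNumberIs (sK3∨K1 s) ((2 * (suc (3 * s) ∸ 1)) / 3 + 1)
proposition3p14 s 2≤s =
  subst (FortNumberIs G) (sym (3*n/3+1≡1+n s)) fort-number ,
  fractional-zero-forcing-number 2≤s ,
  subst (ZeroForcingNumberIs G) (sym (trans (cong (λ m → m / 3 + 1) 2*[3*s]≡3*[s*2]) (3*n/3+1≡1+n (s * 2))))
    zero-forcing-number
  where
    open Triangles s
    2*[3*s]≡3*[s*2] : 2 * (3 * s) ≡ 3 * (s * 2)
    2*[3*s]≡3*[s*2] = trans (ℕ.*-comm 2 (3 * s)) (ℕ.*-assoc 3 s 2)
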